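{- Let $H$ be an ordered graph with vertex set $[h]$. If $\chi^*_{cr}(H)<\chi_<(H)$, then $H$ is flexible.
   Context: An ordered graph on $h$ vertices is a graph with vertex set $[h]$ (ordered naturally); an ordered graph $G$ contains $H$ if there is an order-preserving injection $V(H)\to V(G)$ mapping edges to edges. For sets of integers, $X<Y$ means $a<b$ for all $a\in X,b\in Y$. An interval $r$-colouring of $H$ is a partition of $[h]$ into $r$ intervals $V_1<\dots<V_r$ (some possibly empty) with no edge of $H$ inside any interval; $\chi_<(H)$ is the least such $r$. With $r:=\chi_<(H)$, $H$ is flexible if for every $i\in[r-1]$ there is an interval $(r+1)$-colouring $V_1<\dots<V_i<\{x\}<V_{i+1}<\dots<V_r$ of $H$ such that both $V_1<\dots<V_i\cup\{x\}<V_{i+1}<\dots<V_r$ and $V_1<\dots<V_i<V_{i+1}\cup\{x\}<\dots<V_r$ are interval $r$-colourings of $H$. An $H$-tiling is a collection of vertex-disjoint copies of $H$; perfect if it covers all vertices. For a complete $k$-partite unordered graph $B$ with parts $U_1,\dots,U_k$ and a permutation $\sigma$ of $[k]$, an interval labelling w.r.t. $\sigma$ is a bijection $\phi:V(B)\to[|B|]$ with $\phi(U_i)<\phi(U_j)$ when $\sigma(i)<\sigma(j)$; the ordered blow-up $(B(t),\phi)$ replaces each vertex $x$ by $t$ independent vertices $V_x$ (complete bipartite between $V_x,V_y$ when $xy\in E(B)$) ordered so that $V_x<V_y$ when $\phi(x)<\phi(y)$. $B$ is a bottlegraph of $H$ if for every such $\sigma,\phi$ there is $t$ with $(B(t),\phi)$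 containing a perfect $H$-tiling. $\chi_{cr}(F)=(\chi(F)-1)|F|/(|F|-\sigma(F))$ for unordered $F$, with $\sigma(F)$ the least size of a colour class over proper $\chi(F)$-colourings; $\chi^*_{cr}(H)=\inf\{\chi_{cr}(B): B \text{ a bottlegraph of } H\}$. -}

module Defs where

open import Data.Nat using (ℕ; zero; suc; _+_; _*_; _∸_; _<_; _≤_; pred; _<ᵇ_)
open import Data.Bool using (Bool; true; false; not; if_then_else_)
open import Data.Fin using (Fin; quotient) renaming (_<_ to _<ᶠ_; _≤_ to _≤ᶠ_)
import Data.Fin as F
open import Data.Fin.Permutation using (Permutation′; _⟨$⟩ʳ_; _⟨$⟩ˡ_)
open import Data.List using (List; length; filter; allFin)
open import Data.Fin.Base using ()
open import Data.List using ()
open import Data.Product using (Σ; ∃; _×_; _,_)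
open import Relation.Nullary using (¬_)
open import Relation.Nullary.Decidable using (⌊_⌋)
open import Relation.Binary.PropositionalEquality using (_≡_; _≢_)

OGraph : ℕ → Set
OGraph h = Fin h → Fin h → Bool

IsSimple : ∀ {h} → OGraph h → Set
IsSimple {h} H = (∀ x y → H x y ≡ H y x) × (∀ x → H x x ≡ false)

-- An interval r-colouring V_1 < ... < V_r is encoded
-- by the colour map c : [h] → {0,…,r-1} (V_j = c⁻¹(j-1)), which must be
-- monotone (so classes are intervals, in order) and proper.

IsIntervalColouring : ∀ {h} → OGraph h → ℕ → (Fin h → ℕ) → Set
IsIntervalColouring {h} H r c =
  (∀ x → c x < r) ×
  (∀ x y → x ≤ᶠ y → c x ≤ c y) ×
  (∀ x y → H x y ≡ true → c x ≢ c y)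

HasIntervalColouring : ∀ {h} → OGraph h → ℕ → Set
HasIntervalColouring {h} H r = Σ (Fin h → ℕ) (IsIntervalColouring H r)

IsIntervalChromatic : ∀ {h} → OGraph h → ℕ → Set
IsIntervalChromatic H r =
  HasIntervalColouring H r × (∀ r′ → r′ < r → ¬ HasIntervalColouring H r′)

-- Flexibility.
-- shiftAbove k c : colours > k are decreased by one (merging class k+1
-- into class k, in 0-based colours).

shiftAbove : ℕ → ℕ → ℕ
shiftAbove k n = if k <ᵇ n then pred n else n

-- For i ∈ [r-1]: an interval (r+1)-colouring whose (0-based) colour i is
-- exactly {x} (so V_1..V_i have colours 0..i-1, {x} colour i, and
-- V_{i+1},…,V_r colours i+1,…,r), such that merging {x} into V_i
-- (shiftAbove (i-1)) and merging {x} into V_{i+1} (shiftAbove i) both give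
-- interval r-colourings.
Flexible : ∀ {h} → OGraph h → ℕ → Set
Flexible {h} H r =
  ∀ i → 1 ≤ i → i < r →
  Σ (Fin h) λ x → Σ (Fin h → ℕ) λ c →
    IsIntervalColouring H (suc r) c ×
    c x ≡ i × (∀ y → c y ≡ i → y ≡ x) ×
    IsIntervalColouring H r (λ y → shiftAbove (pred i) (c y)) ×
    IsIntervalColouring H r (λ y → shiftAbove i (c y))

IsEmbedding : ∀ {h m} → OGraph h → OGraph m → (Fin h → Fin m) → Set
IsEmbedding {h} {m} H G f =
  (∀ x y → x <ᶠ y → f x <ᶠ f y) ×
  (∀ x y → H x y ≡ true → G (f x) (f y) ≡ true)

PerfectTiling : ∀ {h m} → OGraph h → OGraph m → Set
PerfectTiling {h} {m} H G =
  Σ ℕ λ q → Σ (Fin q → Fin h → Fin m) λ f →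
    (∀ j → IsEmbedding H G (f j)) ×
    (∀ j j′ u u′ → f j u ≡ f j′ u′ → (j ≡ j′ × u ≡ u′)) ×
    (∀ v → Σ (Fin q) λ j → Σ (Fin h) λ u → f j u ≡ v)

-- Complete k-partite (unordered) graphs.  Vertex set Fin n, part map
-- p : Fin n → Fin k (U_i = p⁻¹(i)); x ~ y iff p x ≠ p y.

UGraph : ℕ → Set
UGraph n = Fin n → Fin n → Bool

completePartite : ∀ {n k} → (Fin n → Fin k) → UGraph n
completePartite p x y = not ⌊ p x F.≟ p y ⌋

PartsNonempty : ∀ {n k} → (Fin n → Fin k) → Set
PartsNonempty {n} {k} p = ∀ i → Σ (Fin n) λ x → p x ≡ i

IsIntervalLabelling : ∀ {n k} → (Fin n → Fin k) → Permutation′ k → Permutation′ n → Set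
IsIntervalLabelling {n} p σ φ =
  ∀ x y → (σ ⟨$⟩ʳ p x) <ᶠ (σ ⟨$⟩ʳ p y) → (φ ⟨$⟩ʳ x) <ᶠ (φ ⟨$⟩ʳ y)

-- ordered blow-up (B(t), φ): vertex set [n·t]; the block of vertices
-- {a·t, …, a·t + t - 1} is V_x for the vertex x = φ⁻¹(a); blocks are
-- independent and V_x, V_y complete to each other iff xy ∈ E(B).
blowUp : ∀ {n k} → (Fin n → Fin k) → Permutation′ n → (t : ℕ) → OGraph (n * t)
blowUp {n} p φ t u v =
  completePartite p (φ ⟨$⟩ˡ quotient t u) (φ ⟨$⟩ˡ quotient t v)

-- B is a bottlegraph of H (t ranges over positive integers)
IsBottlegraph : ∀ {h n k} → OGraph h → (Fin n → Fin k) → Set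
IsBottlegraph {h} {n} {k} H p =
  (σ : Permutation′ k) (φ : Permutation′ n) → IsIntervalLabelling p σ φ →
  Σ ℕ λ t → PerfectTiling H (blowUp p φ (suc t))

IsProperColouring : ∀ {n} → UGraph n → (k : ℕ) → (Fin n → Fin k) → Set
IsProperColouring {n} F k c = ∀ x y → F x y ≡ true → c x ≢ c y

Colourable : ∀ {n} → UGraph n → ℕ → Set
Colourable {n} F k = Σ (Fin n → Fin k) (IsProperColouring F k)

IsChromaticNumber : ∀ {n} → UGraph n → ℕ → Set
IsChromaticNumber F k = Colourable F k × (∀ j → j < k → ¬ Colourable F j)

classSize : ∀ {n k} → (Fin n → Fin k) → Fin k → ℕ
classSize {n} c j = length (filter (λ v → c v F.≟ j) (allFin n))

IsSigma : ∀ {n} → UGraph n → ℕ → ℕ → Set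
IsSigma {n} F χ s =
  (Σ (Fin n → Fin χ) λ c → IsProperColouring F χ c × Σ (Fin χ) λ j → classSize c j ≡ s) ×
  (∀ (c : Fin n → Fin χ) → IsProperColouring F χ c → ∀ j → s ≤ classSize c j)

-- χ_cr(F) < r, where χ_cr(F) = (χ(F) - 1)|F| / (|F| - σ(F)); the quotient
-- is only defined when σ(F) < |F|, and the comparison is cross-multiplied.
CriticalChromaticBelow : ∀ {n} → UGraph n → ℕ → Set
CriticalChromaticBelow {n} F r =
  Σ ℕ λ χ → Σ ℕ λ s → IsChromaticNumber F χ × IsSigma F χ s ×
    s < n × (χ ∸ 1) * n < r * (n ∸ s)

-- χ*_cr(H) < r : some bottlegraph B of H has χ_cr(B) < r
-- (inf of a set is < r iff some element is < r)
CrStarBelow : ∀ {h} → OGraph h → ℕ → Set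
CrStarBelow H r =
  Σ ℕ λ k → Σ ℕ λ n → Σ (Fin n → Fin k) λ p →
    PartsNonempty p × IsBottlegraph H p × CriticalChromaticBelow (completePartite p) r

-- Fix 1 ≤ i < r. If interval r-colourings c₁, c₂ and a vertex z satisfy
-- c₁ z < i ≤ c₂ z, then colouring the vertices before z by c₁, z alone by i and
-- the vertices after z by c₂ + 1 shows that H is flexible at i. Otherwise every
-- interval r-colouring puts the same number β of vertices into its first i
-- classes. Let B be a complete k-partite bottlegraph of H with χ_cr(B) < r. Then
-- χ(B) = k ≤ r, and a copy of H in an ordered blow-up of B is interval
-- k-coloured by the position of its part, so k = r. Double counting a perfect
-- H-tiling of a blow-up ordered by σ shows that the parts placed first by σ
-- contain nβ/h vertices together, for every σ; comparing σ with a transposition,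
-- all parts have the same size. A balanced complete k-partite graph has
-- χ_cr = k = r, a contradiction. Constructively, each step returns either
-- flexibility at i or the equation needed next.

module Submission where

open import Defs
open import Data.Nat
open import Data.Nat.Properties
open import Data.Bool using (true; false; T; if_then_else_)
open import Data.Unit using (tt)
open import Data.Empty using (⊥-elim)
open import Data.Fin
  using (Fin; zero; suc; toℕ; fromℕ<; punchIn; punchOut; _↑ˡ_; _↑ʳ_; combine; remQuot; quotient; remainder)
  renaming (_<_ to _<ᶠ_; _≤_ to _≤ᶠ_)
import Data.Fin.Properties as Fin
open import Data.Fin.Properties using (sequence)
open import Data.Fin.Permutation
  using (Permutation; Permutation′; permutation; _⟨$⟩ʳ_; _⟨$⟩ˡ_; flip; insert; insert-punchIn; inverseʳ)
import Data.Fin.Permutation as Perm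
import Data.Fin.Permutation.Components as PC
open import Data.List using (length; filter; tabulate)
open import Data.Product using (Σ; _×_; _,_; proj₁; proj₂; uncurry)
open import Data.Sum using (_⊎_; inj₁; inj₂; [_,_]′; map₂)
import Data.Sum.Effectful.Left as SumLeft
open import Effect.Monad using (RawMonad)
open import Function using (_∘_; id)
open import Function.Bundles using (Injection)
open import Function.Definitions using (Injective)
open import Function.Properties.Inverse using (↔⇒↣)
open import Level using (0ℓ)
open import Relation.Nullary using (¬_; Dec; does; yes; no)
open import Relation.Nullary.Decidable using (dec-true; dec-false)
open import Relation.Unary using (Decidable)
open import Relation.Binary using (tri<; tri≈; tri>)
open import Relation.Binary.PropositionalEquality
open import Algebra.Properties.CommutativeSemigroup *-commutativeSemigroup
  using (xy∙z≈xz∙y; xy∙z≈y∙xz; x∙yz≈y∙xz)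
open import Algebra.Properties.Semiring.Sum +-*-semiring
  using (sum; sum-syntax; sum-cong-≗; sum-permute; ∑-comm; ∑-distrib-+; *-distribˡ-sum)

-- Finite sums and counting

indicator : ∀ {p} {P : Set p} → Dec P → ℕ
indicator P? = if does P? then 1 else 0

∑-const : ∀ n c → ∑[ i < n ] c ≡ n * c
∑-const zero    c = refl
∑-const (suc n) c = cong (c +_) (∑-const n c)

∑-mono-≤ : ∀ {n} {f g : Fin n → ℕ} → (∀ i → f i ≤ g i) → sum f ≤ sum g
∑-mono-≤ {zero}  f≤g = z≤n
∑-mono-≤ {suc n} f≤g = +-mono-≤ (f≤g zero) (∑-mono-≤ (f≤g ∘ suc))

∑-split : ∀ m {n} (f : Fin (m + n) → ℕ) →
          sum f ≡ ∑[ i < m ] f (i ↑ˡ n) + ∑[ j < n ] f (m ↑ʳ j)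
∑-split zero    f = refl
∑-split (suc m) f = trans (cong (f zero +_) (∑-split m (f ∘ suc)))
                          (sym (+-assoc (f zero) _ _))

∑-combine : ∀ m {n} (f : Fin (m * n) → ℕ) →
            sum f ≡ ∑[ i < m ] ∑[ j < n ] f (combine i j)
∑-combine zero    f = refl
∑-combine (suc m) {n} f =
  trans (∑-split n f) (cong (∑[ j < n ] f (j ↑ˡ (m * n)) +_) (∑-combine m (λ v → f (n ↑ʳ v))))

Disjoint : ∀ {q h N} → (Fin q → Fin h → Fin N) → Set
Disjoint {q} {h} f = ∀ j j′ u u′ → f j u ≡ f j′ u′ → j ≡ j′ × u ≡ u′

Covering : ∀ {q h N} → (Fin q → Fin h → Fin N) → Set
Covering {q} {h} {N} f = ∀ v → Σ (Fin q) λ j → Σ (Fin h) λ u → f j u ≡ v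

∑-bijection : ∀ {q h N} (f : Fin q → Fin h → Fin N) → Disjoint f → Covering f →
              (w : Fin N → ℕ) → sum w ≡ ∑[ j < q ] ∑[ u < h ] w (f j u)
∑-bijection {q} {h} {N} f disjoint covering w = begin
  sum w                               ≡⟨ sum-permute w π ⟩
  ∑[ c < q * h ] w (to c)             ≡⟨ ∑-combine q (w ∘ to) ⟩
  ∑[ j < q ] ∑[ u < h ] w (to (combine j u))
    ≡⟨ sum-cong-≗ (λ j → sum-cong-≗ (λ u → cong (w ∘ uncurry f) (Fin.remQuot-combine j u))) ⟩
  ∑[ j < q ] ∑[ u < h ] w (f j u)     ∎
  where
  open ≡-Reasoning
  to : Fin (q * h) → Fin N
  to = uncurry f ∘ remQuot h
  from : Fin N → Fin (q * h)
  from v = combine (proj₁ (covering v)) (proj₁ (proj₂ (covering v)))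
  π : Permutation (q * h) N
  π = permutation to from to∘from from∘to
    where
    to∘from : ∀ v → to (from v) ≡ v
    to∘from v with j , u , fju≡v ← covering v =
      trans (cong (uncurry f) (Fin.remQuot-combine j u)) fju≡v
    from∘to : ∀ c → from (to c) ≡ c
    from∘to c with covering (to c)
    ... | j , u , fju≡ with refl , refl ← disjoint j _ u _ fju≡ = Fin.combine-remQuot {q} h c

∑-quotient : ∀ n t (g : Fin n → ℕ) → ∑[ v < n * t ] g (quotient t v) ≡ t * sum g
∑-quotient n t g = begin
  ∑[ v < n * t ] g (quotient t v)                     ≡⟨ ∑-combine n _ ⟩
  ∑[ a < n ] ∑[ b < t ] g (quotient t (combine a b))
    ≡⟨ sum-cong-≗ (λ a → sum-cong-≗ (λ b → cong (g ∘ proj₁) (Fin.remQuot-combine {k = t} a b))) ⟩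
  ∑[ a < n ] ∑[ b < t ] g a                           ≡⟨ sum-cong-≗ (λ a → ∑-const t (g a)) ⟩
  ∑[ a < n ] (t * g a)                               ≡⟨ *-distribˡ-sum t g ⟨
  t * sum g                                           ∎
  where open ≡-Reasoning

length-filter-tabulate : ∀ {n a p} {A : Set a} {P : A → Set p} (P? : Decidable P) (g : Fin n → A) →
                         length (filter P? (tabulate g)) ≡ ∑[ x < n ] indicator (P? (g x))
length-filter-tabulate {zero}  P? g = refl
length-filter-tabulate {suc n} P? g with does (P? (g zero))
... | true  = cong suc (length-filter-tabulate P? (g ∘ suc))
... | false = length-filter-tabulate P? (g ∘ suc)

∑-indicator-≡ : ∀ {k} (b : Fin k) → ∑[ a < k ] indicator (b Fin.≟ a) ≡ 1
∑-indicator-≡ {suc k} zero    = cong suc (trans (∑-const k 0) (*-zeroʳ k))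
∑-indicator-≡         (suc b) = ∑-indicator-≡ b

indicator-transpose : ∀ {k i} (a b y : Fin k) → toℕ a < i → i ≤ toℕ b →
  indicator (toℕ y <? i) + indicator (y Fin.≟ b) ≡
  indicator (toℕ (PC.transpose a b y) <? i) + indicator (y Fin.≟ a)
indicator-transpose {i = i} a b y a<i i≤b with y Fin.≟ a | y Fin.≟ b
... | yes refl | yes refl = ⊥-elim (<⇒≱ a<i i≤b)
... | yes refl | no _
  rewrite dec-true (toℕ a <? i) a<i | dec-false (toℕ b <? i) (≤⇒≯ i≤b) = refl
... | no _     | yes refl
  rewrite dec-true (b Fin.≟ b) refl
        | dec-true (toℕ a <? i) a<i | dec-false (toℕ b <? i) (≤⇒≯ i≤b) = refl
... | no _     | no y≢b   rewrite dec-false (y Fin.≟ b) y≢b = refl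

pred*<*∸⇒≤ : ∀ a b n s → (a ∸ 1) * n < b * (n ∸ s) → a ≤ b
pred*<*∸⇒≤ zero    b n s _     = z≤n
pred*<*∸⇒≤ (suc a) b n s bound = *-cancelʳ-< n a b (<-≤-trans bound (*-monoʳ-≤ b (m∸n≤m n s)))

*∸≤pred* : ∀ k M {s} → M ≤ s → k * (k * M ∸ s) ≤ (k ∸ 1) * (k * M)
*∸≤pred* k M {s} M≤s = begin
  k * (k * M ∸ s)     ≤⟨ *-monoʳ-≤ k (∸-monoʳ-≤ (k * M) M≤s) ⟩
  k * (k * M ∸ M)     ≡⟨ cong (λ m → k * (k * M ∸ m)) (*-identityˡ M) ⟨
  k * (k * M ∸ 1 * M) ≡⟨ cong (k *_) (*-distribʳ-∸ M k 1) ⟨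
  k * ((k ∸ 1) * M)   ≡⟨ x∙yz≈y∙xz k (k ∸ 1) M ⟩
  (k ∸ 1) * (k * M)   ∎
  where open ≤-Reasoning

-- Finite sets and permutations

injective⇒surjective : ∀ {k} {f : Fin k → Fin k} → Injective _≡_ _≡_ f →
                       ∀ j → Σ (Fin k) λ a → f a ≡ j
injective⇒surjective {suc k} {f} f-inj j with Fin.any? (λ a → f a Fin.≟ j)
... | yes hit = hit
... | no miss = ⊥-elim (Fin.<⇒notInjective (n<1+n k) f′-inj)
  where
  f≢j : ∀ a → j ≢ f a
  f≢j a j≡fa = miss (a , sym j≡fa)
  f′ : Fin (suc k) → Fin k
  f′ a = punchOut (f≢j a)
  f′-inj : Injective _≡_ _≡_ f′
  f′-inj = f-inj ∘ Fin.punchOut-injective (f≢j _) (f≢j _)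

argmin : ∀ {n} (f : Fin (suc n) → ℕ) → Σ (Fin (suc n)) λ x₀ → ∀ y → f x₀ ≤ f y
argmin {zero}  f = zero , λ { zero → ≤-refl }
argmin {suc n} f with x₁ , min₁ ← argmin (f ∘ suc) | f zero ≤? f (suc x₁)
... | yes f₀≤ = zero , λ { zero → ≤-refl ; (suc y) → ≤-trans f₀≤ (min₁ y) }
... | no f₀≰ = suc x₁ , λ { zero → <⇒≤ (≰⇒> f₀≰) ; (suc y) → min₁ y }

insert-self : ∀ {m n} i j (π : Permutation m n) → insert i j π ⟨$⟩ʳ i ≡ j
insert-self i j π with i Fin.≟ i
... | yes _   = refl
... | no i≢i = ⊥-elim (i≢i refl)

sortingPermutation : ∀ n (f : Fin n → ℕ) →
  Σ (Permutation′ n) λ φ → ∀ x y → f x < f y → (φ ⟨$⟩ʳ x) <ᶠ (φ ⟨$⟩ʳ y)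
sortingPermutation zero    f = Perm.id , λ ()
sortingPermutation (suc n) f
  with x₀ , min ← argmin f
  with φ′ , sorted′ ← sortingPermutation n (f ∘ punchIn x₀) =
  φ , sorted
  where
  φ : Permutation′ (suc n)
  φ = insert x₀ zero φ′
  φ-punchIn : ∀ {x} (x₀≢x : x₀ ≢ x) → φ ⟨$⟩ʳ x ≡ suc (φ′ ⟨$⟩ʳ punchOut x₀≢x)
  φ-punchIn x₀≢x = trans (cong (φ ⟨$⟩ʳ_) (sym (Fin.punchIn-punchOut x₀≢x)))
                         (insert-punchIn x₀ zero φ′ (punchOut x₀≢x))
  f-punchIn : ∀ {x} (x₀≢x : x₀ ≢ x) → f (punchIn x₀ (punchOut x₀≢x)) ≡ f x
  f-punchIn x₀≢x = cong f (Fin.punchIn-punchOut x₀≢x)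
  sorted : ∀ x y → f x < f y → (φ ⟨$⟩ʳ x) <ᶠ (φ ⟨$⟩ʳ y)
  sorted x y fx<fy with x Fin.≟ x₀ | y Fin.≟ x₀
  ... | _        | yes refl = ⊥-elim (<⇒≱ fx<fy (min x))
  ... | yes refl | no y≢x₀  =
    subst₂ _<ᶠ_ (sym (insert-self x₀ zero φ′)) (sym (φ-punchIn (≢-sym y≢x₀))) z<s
  ... | no x≢x₀  | no y≢x₀  =
    subst₂ _<ᶠ_ (sym (φ-punchIn (≢-sym x≢x₀))) (sym (φ-punchIn (≢-sym y≢x₀)))
      (s<s (sorted′ _ _ (subst₂ _<_ (sym (f-punchIn _)) (sym (f-punchIn _)) fx<fy)))

quotient-mono : ∀ {m} t {v v′ : Fin (m * t)} → v ≤ᶠ v′ →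
                quotient {m} t v ≤ᶠ quotient {m} t v′
quotient-mono {m} t {v} {v′} v≤v′ = ≮⇒≥ λ q′<q → <⇒≱
  (subst₂ _<ᶠ_ (Fin.combine-remQuot {m} t v′) (Fin.combine-remQuot {m} t v)
    (Fin.combine-monoˡ-< (remainder {m} t v′) (remainder {m} t v) q′<q))
  v≤v′

-- Interval colourings and flexibility

shiftAbove-≤ : ∀ {k n} → n ≤ k → shiftAbove k n ≡ n
shiftAbove-≤ {k} {n} n≤k with k <ᵇ n in eq
... | true  = ⊥-elim (<⇒≱ (<ᵇ⇒< k n (subst T (sym eq) tt)) n≤k)
... | false = refl

shiftAbove-> : ∀ {k n} → k < n → shiftAbove k n ≡ pred n
shiftAbove-> {k} {n} k<n with k <ᵇ n in eq
... | true  = refl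
... | false = ⊥-elim (subst T eq (<⇒<ᵇ k<n))

FlexibleAt : ∀ {h} → OGraph h → ℕ → ℕ → Set
FlexibleAt {h} H r i =
  Σ (Fin h) λ x → Σ (Fin h → ℕ) λ c →
    IsIntervalColouring H (suc r) c ×
    c x ≡ i × (∀ y → c y ≡ i → y ≡ x) ×
    IsIntervalColouring H r (λ y → shiftAbove (pred i) (c y)) ×
    IsIntervalColouring H r (λ y → shiftAbove i (c y))

Increasing : ∀ {h} → OGraph h → (Fin h → ℕ) → Set
Increasing {h} H c = ∀ {y w} → y <ᶠ w → c y ≤ c w × (H y w ≡ true → c y < c w)

module _ {h} {H : OGraph h} where

  intervalColouring-≗ : ∀ {r} {c d : Fin h → ℕ} → (∀ y → c y ≡ d y) →
                        IsIntervalColouring H r c → IsIntervalColouring H r d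
  intervalColouring-≗ c≗d (bounded , monotone , proper) =
    (λ x → subst (_< _) (c≗d x) (bounded x)) ,
    (λ x y x≤y → subst₂ _≤_ (c≗d x) (c≗d y) (monotone x y x≤y)) ,
    (λ x y xy → proper x y xy ∘ λ dx≡dy → trans (c≗d x) (trans dx≡dy (sym (c≗d y))))

  intervalColouring-≤ : ∀ {r r′ c} → r ≤ r′ →
                        IsIntervalColouring H r c → IsIntervalColouring H r′ c
  intervalColouring-≤ r≤r′ (bounded , monotone , proper) =
    (λ x → <-≤-trans (bounded x) r≤r′) , monotone , proper

  intervalColouring-suc : ∀ {r c} → IsIntervalColouring H r c →
                          IsIntervalColouring H (suc r) (suc ∘ c)
  intervalColouring-suc (bounded , monotone , proper) =
    s≤s ∘ bounded , (λ x y x≤y → s≤s (monotone x y x≤y)) ,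
    (λ x y xy → proper x y xy ∘ suc-injective)

  intervalColouring⇒increasing : ∀ {r c} → IsIntervalColouring H r c → Increasing H c
  intervalColouring⇒increasing (_ , monotone , proper) {y} {w} y<w =
    monotone y w (<⇒≤ y<w) , λ yw → ≤∧≢⇒< (monotone y w (<⇒≤ y<w)) (proper y w yw)

countBelow : ∀ {h} → ℕ → (Fin h → ℕ) → ℕ
countBelow {h} i c = ∑[ y < h ] indicator (c y <? i)

module IntervalColourings {h} (H : OGraph h) (simple : IsSimple H) where

  loopless : ∀ x → H x x ≢ true
  loopless x xx with () ← trans (sym (proj₂ simple x)) xx

  increasing⇒intervalColouring : ∀ {r c} → (∀ x → c x < r) → Increasing H c →
                                 IsIntervalColouring H r c
  increasing⇒intervalColouring {c = c} bounded increasing = bounded , monotone , proper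
    where
    monotone : ∀ x y → x ≤ᶠ y → c x ≤ c y
    monotone x y x≤y with Fin.<-cmp x y
    ... | tri< x<y _ _ = proj₁ (increasing x<y)
    ... | tri≈ _ refl _ = ≤-refl
    ... | tri> _ _ y<x = ⊥-elim (<⇒≱ y<x x≤y)
    proper : ∀ x y → H x y ≡ true → c x ≢ c y
    proper x y xy with Fin.<-cmp x y
    ... | tri< x<y _ _ = <⇒≢ (proj₂ (increasing x<y) xy)
    ... | tri≈ _ refl _ = λ _ → loopless x xy
    ... | tri> _ _ y<x = ≢-sym (<⇒≢ (proj₂ (increasing y<x) (trans (proj₁ simple y x) xy)))

  splice : Fin h → (Fin h → ℕ) → ℕ → (Fin h → ℕ) → Fin h → ℕ
  splice z c₁ v c₂ y with Fin.<-cmp y z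
  ... | tri< _ _ _ = c₁ y
  ... | tri≈ _ _ _ = v
  ... | tri> _ _ _ = c₂ y

  splice-at : ∀ z c₁ v c₂ → splice z c₁ v c₂ z ≡ v
  splice-at z c₁ v c₂ with Fin.<-cmp z z
  ... | tri< z<z _ _ = ⊥-elim (Fin.<-irrefl refl z<z)
  ... | tri≈ _ _ _   = refl
  ... | tri> _ _ z<z = ⊥-elim (Fin.<-irrefl refl z<z)

  splice-intervalColouring : ∀ {r c₁ c₂} z v →
    IsIntervalColouring H r c₁ → IsIntervalColouring H r c₂ →
    c₁ z ≤ v → v ≤ c₂ z → c₁ z < c₂ z → v < r →
    IsIntervalColouring H r (splice z c₁ v c₂)
  splice-intervalColouring {r} {c₁} {c₂} z v C₁ C₂ c₁z≤v v≤c₂z c₁z<c₂z v<r =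
    increasing⇒intervalColouring bounded increasing
    where
    bounded : ∀ y → splice z c₁ v c₂ y < r
    bounded y with Fin.<-cmp y z
    ... | tri< _ _ _ = proj₁ C₁ y
    ... | tri≈ _ _ _ = v<r
    ... | tri> _ _ _ = proj₁ C₂ y
    increasing : Increasing H (splice z c₁ v c₂)
    increasing {y} {w} y<w with Fin.<-cmp y z | Fin.<-cmp w z
    ... | tri< _ _ _   | tri< _ _ _   = intervalColouring⇒increasing C₁ y<w
    ... | tri< _ _ _   | tri≈ _ refl _ =
      let c₁y≤c₁z , c₁y<c₁z = intervalColouring⇒increasing C₁ y<w
      in ≤-trans c₁y≤c₁z c₁z≤v , λ yw → <-≤-trans (c₁y<c₁z yw) c₁z≤v
    ... | tri< y<z _ _ | tri> _ _ z<w  =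
      let c₁y<c₂w = ≤-<-trans (proj₁ (intervalColouring⇒increasing C₁ y<z))
                      (<-≤-trans c₁z<c₂z (proj₁ (intervalColouring⇒increasing C₂ z<w)))
      in <⇒≤ c₁y<c₂w , λ _ → c₁y<c₂w
    ... | tri≈ _ refl _ | tri< w<y _ _  = ⊥-elim (Fin.<-asym y<w w<y)
    ... | tri≈ _ refl _ | tri≈ _ refl _ = ⊥-elim (Fin.<-irrefl refl y<w)
    ... | tri≈ _ refl _ | tri> _ _ _    =
      let c₂y≤c₂w , c₂y<c₂w = intervalColouring⇒increasing C₂ y<w
      in ≤-trans v≤c₂z c₂y≤c₂w , λ yw → ≤-<-trans v≤c₂z (c₂y<c₂w yw)
    ... | tri> _ _ z<y | tri< w<z _ _   = ⊥-elim (Fin.<-asym y<w (Fin.<-trans w<z z<y))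
    ... | tri> _ _ z<y | tri≈ _ refl _  = ⊥-elim (Fin.<-asym y<w z<y)
    ... | tri> _ _ _   | tri> _ _ _     = intervalColouring⇒increasing C₂ y<w

  shiftAbove-splice : ∀ {r r′ c₁ c₂ z k v v′} →
    IsIntervalColouring H r c₁ → IsIntervalColouring H r′ c₂ →
    c₁ z ≤ k → k ≤ c₂ z → shiftAbove k v ≡ v′ →
    ∀ y → shiftAbove k (splice z c₁ v (suc ∘ c₂) y) ≡ splice z c₁ v′ c₂ y
  shiftAbove-splice {z = z} (_ , mono₁ , _) (_ , mono₂ , _) c₁z≤k k≤c₂z v↦v′ y
    with Fin.<-cmp y z
  ... | tri< y<z _ _ = shiftAbove-≤ (≤-trans (mono₁ y z (<⇒≤ y<z)) c₁z≤k)
  ... | tri≈ _ _ _   = v↦v′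
  ... | tri> _ _ z<y = shiftAbove-> (s≤s (≤-trans k≤c₂z (mono₂ z y (<⇒≤ z<y))))

  -- Merging the singleton class {z} down or up gives back splices of c₁ and c₂.
  crossing⇒flexibleAt : ∀ {r c₁ c₂ i} z →
    IsIntervalColouring H r c₁ → IsIntervalColouring H r c₂ →
    1 ≤ i → i < r → c₁ z < i → i ≤ c₂ z → FlexibleAt H r i
  crossing⇒flexibleAt {r} {c₁} {c₂} {i} z C₁@(_ , mono₁ , _) C₂@(_ , mono₂ , _)
                      1≤i i<r c₁z<i i≤c₂z =
    z , c , C , splice-at z c₁ i (suc ∘ c₂) , only-z ,
    intervalColouring-≗ (sym ∘ shiftAbove-splice C₁ C₂ c₁z≤pred[i] pred[i]≤c₂z shiftAbove-i)
      (splice-intervalColouring z (pred i) C₁ C₂ c₁z≤pred[i] pred[i]≤c₂z c₁z<c₂z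
         (≤-<-trans pred[n]≤n i<r)) ,
    intervalColouring-≗ (sym ∘ shiftAbove-splice C₁ C₂ (<⇒≤ c₁z<i) i≤c₂z (shiftAbove-≤ ≤-refl))
      (splice-intervalColouring z i C₁ C₂ (<⇒≤ c₁z<i) i≤c₂z c₁z<c₂z i<r)
    where
    c : Fin h → ℕ
    c = splice z c₁ i (suc ∘ c₂)
    c₁z<c₂z : c₁ z < c₂ z
    c₁z<c₂z = <-≤-trans c₁z<i i≤c₂z
    c₁z≤pred[i] : c₁ z ≤ pred i
    c₁z≤pred[i] = suc[m]≤n⇒m≤pred[n] c₁z<i
    pred[i]≤c₂z : pred i ≤ c₂ z
    pred[i]≤c₂z = ≤-trans pred[n]≤n i≤c₂z
    shiftAbove-i : shiftAbove (pred i) i ≡ pred i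
    shiftAbove-i = shiftAbove-> (≤-reflexive (suc-pred i {{>-nonZero 1≤i}}))
    C : IsIntervalColouring H (suc r) c
    C = splice-intervalColouring z i (intervalColouring-≤ (n≤1+n r) C₁)
          (intervalColouring-suc C₂) (<⇒≤ c₁z<i) (m≤n⇒m≤1+n i≤c₂z)
          (m≤n⇒m≤1+n c₁z<c₂z) (m<n⇒m<1+n i<r)
    only-z : ∀ y → c y ≡ i → y ≡ z
    only-z y cy≡i with Fin.<-cmp y z
    ... | tri< y<z _ _ = ⊥-elim (<-irrefl cy≡i (≤-<-trans (mono₁ y z (<⇒≤ y<z)) c₁z<i))
    ... | tri≈ _ y≡z _ = y≡z
    ... | tri> _ _ z<y =
      ⊥-elim (<-irrefl (sym cy≡i) (s≤s (≤-trans i≤c₂z (mono₂ z y (<⇒≤ z<y)))))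

  flexibleAt-or-countBelow-≡ : ∀ {r c d i} →
    IsIntervalColouring H r c → IsIntervalColouring H r d → 1 ≤ i → i < r →
    FlexibleAt H r i ⊎ countBelow i c ≡ countBelow i d
  flexibleAt-or-countBelow-≡ {r} {c} {d} {i} C D 1≤i i<r =
    map₂ sum-cong-≗ (sequence applicative agreeAt)
    where
    open SumLeft (FlexibleAt H r i) 0ℓ using (applicative)
    agreeAt : ∀ y → FlexibleAt H r i ⊎ indicator (c y <? i) ≡ indicator (d y <? i)
    agreeAt y with c y <? i | d y <? i
    ... | yes cy<i | yes dy<i
      rewrite dec-true (c y <? i) cy<i | dec-true (d y <? i) dy<i = inj₂ refl
    ... | no cy≮i | no dy≮i
      rewrite dec-false (c y <? i) cy≮i | dec-false (d y <? i) dy≮i = inj₂ refl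
    ... | yes cy<i | no dy≮i = inj₁ (crossing⇒flexibleAt y C D 1≤i i<r cy<i (≮⇒≥ dy≮i))
    ... | no cy≮i | yes dy<i = inj₁ (crossing⇒flexibleAt y D C 1≤i i<r dy<i (≮⇒≥ cy≮i))

-- Ordered blow-ups and their tilings

completePartite-edge⇒≢ : ∀ {n k} (p : Fin n → Fin k) {x y} →
                          completePartite p x y ≡ true → p x ≢ p y
completePartite-edge⇒≢ p {x} {y} xy px≡py with p x Fin.≟ p y | xy
... | yes _    | ()
... | no px≢py | _ = px≢py px≡py

≢⇒completePartite-edge : ∀ {n k} (p : Fin n → Fin k) {x y} →
                          p x ≢ p y → completePartite p x y ≡ true
≢⇒completePartite-edge p {x} {y} px≢py with p x Fin.≟ p y
... | yes px≡py = ⊥-elim (px≢py px≡py)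
... | no _      = refl

intervalLabelling : ∀ {n k} (p : Fin n → Fin k) (σ : Permutation′ k) →
                    Σ (Permutation′ n) (IsIntervalLabelling p σ)
intervalLabelling {n} p σ = sortingPermutation n (toℕ ∘ (σ ⟨$⟩ʳ_) ∘ p)

module _ {n k} (p : Fin n → Fin k) (σ : Permutation′ k) (φ : Permutation′ n)
         (labelling : IsIntervalLabelling p σ φ) where

  blockColour : ∀ t → Fin (n * t) → ℕ
  blockColour t v = toℕ (σ ⟨$⟩ʳ p (φ ⟨$⟩ˡ quotient t v))

  blockColour-mono : ∀ t {v v′} → v ≤ᶠ v′ → blockColour t v ≤ blockColour t v′
  blockColour-mono t v≤v′ = ≮⇒≥ λ c′<c → <⇒≱
    (subst₂ _<ᶠ_ (inverseʳ φ) (inverseʳ φ) (labelling _ _ c′<c))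
    (quotient-mono t v≤v′)

  embedding⇒intervalColouring : ∀ {h t} {H : OGraph h} {e : Fin h → Fin (n * t)} →
    IsEmbedding H (blowUp p φ t) e → IsIntervalColouring H k (blockColour t ∘ e)
  embedding⇒intervalColouring {t = t} {H} {e} (e-mono , e-edge) =
    (λ _ → Fin.toℕ<n _) , monotone , proper
    where
    monotone : ∀ x y → x ≤ᶠ y → blockColour t (e x) ≤ blockColour t (e y)
    monotone x y x≤y with m≤n⇒m<n∨m≡n x≤y
    ... | inj₁ x<y  = blockColour-mono t (<⇒≤ (e-mono x y x<y))
    ... | inj₂ x≡y = ≤-reflexive (cong (blockColour t ∘ e) (Fin.toℕ-injective x≡y))
    proper : ∀ x y → H x y ≡ true → blockColour t (e x) ≢ blockColour t (e y)
    proper x y xy c≡c′ = completePartite-edge⇒≢ p (e-edge x y xy)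
      (Injection.injective (↔⇒↣ σ) (Fin.toℕ-injective c≡c′))

module _ {h N q} (f : Fin q → Fin h → Fin N)
         (disjoint : Disjoint f) (covering : Covering f) where

  tiling-size : N ≡ q * h
  tiling-size = begin
    N                          ≡⟨ *-identityʳ N ⟨
    N * 1                      ≡⟨ ∑-const N 1 ⟨
    ∑[ v < N ] 1               ≡⟨ ∑-bijection f disjoint covering (λ _ → 1) ⟩
    ∑[ j < q ] ∑[ u < h ] 1    ≡⟨ sum-cong-≗ {q} (λ _ → trans (∑-const h 1) (*-identityʳ h)) ⟩
    ∑[ j < q ] h               ≡⟨ ∑-const q h ⟩
    q * h                      ∎
    where open ≡-Reasoning

module _ {h n t q} (f : Fin q → Fin h → Fin (n * suc t))
         (disjoint : Disjoint f) (covering : Covering f) where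

  tiling-blockWeight : (g : Fin n → ℕ) {β : ℕ} →
    (∀ j → ∑[ u < h ] g (quotient (suc t) (f j u)) ≡ β) → sum g * h ≡ n * β
  tiling-blockWeight g {β} copy-weight = *-cancelˡ-≡ _ _ (suc t) (begin
    suc t * (sum g * h)                                 ≡⟨ *-assoc (suc t) (sum g) h ⟨
    (suc t * sum g) * h                                 ≡⟨ cong (_* h) (∑-quotient n (suc t) g) ⟨
    (∑[ v < n * suc t ] g (quotient (suc t) v)) * h
      ≡⟨ cong (_* h) (∑-bijection f disjoint covering _) ⟩
    (∑[ j < q ] ∑[ u < h ] g (quotient (suc t) (f j u))) * h
      ≡⟨ cong (_* h) (trans (sum-cong-≗ copy-weight) (∑-const q β)) ⟩
    (q * β) * h                                         ≡⟨ xy∙z≈xz∙y q β h ⟩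
    (q * h) * β                                         ≡⟨ cong (_* β) (tiling-size f disjoint covering) ⟨
    (n * suc t) * β                                     ≡⟨ xy∙z≈y∙xz n (suc t) β ⟩
    suc t * (n * β)                                     ∎)
    where open ≡-Reasoning

-- Complete multipartite graphs

partSize : ∀ {n k} → (Fin n → Fin k) → Fin k → ℕ
partSize {n} p a = ∑[ x < n ] indicator (p x Fin.≟ a)

∑-partSize : ∀ {n k} (p : Fin n → Fin k) → ∑[ a < k ] partSize p a ≡ n
∑-partSize {n} {k} p = begin
  ∑[ a < k ] ∑[ x < n ] indicator (p x Fin.≟ a) ≡⟨ ∑-comm {k} {n} _ ⟩
  ∑[ x < n ] ∑[ a < k ] indicator (p x Fin.≟ a) ≡⟨ sum-cong-≗ (∑-indicator-≡ ∘ p) ⟩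
  ∑[ x < n ] 1                                   ≡⟨ ∑-const n 1 ⟩
  n * 1                                          ≡⟨ *-identityʳ n ⟩
  n                                              ∎
  where open ≡-Reasoning

completePartite-properColouring : ∀ {n k} (p : Fin n → Fin k) →
                                  IsProperColouring (completePartite p) k p
completePartite-properColouring p x y = completePartite-edge⇒≢ p

module _ {n k} (p : Fin n → Fin k) (nonempty : PartsNonempty p) where

  private
    representative : Fin k → Fin n
    representative a = proj₁ (nonempty a)

    representative-part : ∀ a → p (representative a) ≡ a
    representative-part a = proj₂ (nonempty a)

  properColouring-injective : ∀ {j c} → IsProperColouring (completePartite p) j c →
                              Injective _≡_ _≡_ (c ∘ representative)
  properColouring-injective proper {a} {b} same with a Fin.≟ b
  ... | yes a≡b = a≡b
  ... | no a≢b  = ⊥-elim (proper _ _ (≢⇒completePartite-edge p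
        (λ eq → a≢b (trans (sym (representative-part a)) (trans eq (representative-part b)))))
        same)

  completePartite-chromatic : ∀ {χ} → IsChromaticNumber (completePartite p) χ → χ ≡ k
  completePartite-chromatic ((c , proper) , minimal) = ≤-antisym
    (≮⇒≥ λ k<χ → minimal k k<χ (p , completePartite-properColouring p))
    (Fin.injective⇒≤ (properColouring-injective proper))

  partSize≤classSize : ∀ {c} → IsProperColouring (completePartite p) k c → ∀ j →
                       Σ (Fin k) λ a → partSize p a ≤ classSize c j
  partSize≤classSize {c} proper j
    with a , c[a]≡j ← injective⇒surjective (properColouring-injective proper) j =
    a , subst (partSize p a ≤_) (sym (length-filter-tabulate (λ x → c x Fin.≟ j) id))
              (∑-mono-≤ part⊆class)
    where
    coloured-j : ∀ x → p x ≡ a → c x ≡ j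
    coloured-j x px≡a
      with a′ , c[a′]≡cx ← injective⇒surjective (properColouring-injective proper) (c x)
      with a′ Fin.≟ a
    ... | yes refl = trans (sym c[a′]≡cx) c[a]≡j
    ... | no a′≢a  = ⊥-elim (proper x _ (≢⇒completePartite-edge p
                       (λ eq → a′≢a (trans (sym (representative-part a′)) (trans (sym eq) px≡a))))
                       (sym c[a′]≡cx))
    part⊆class : ∀ x → indicator (p x Fin.≟ a) ≤ indicator (c x Fin.≟ j)
    part⊆class x with p x Fin.≟ a | c x Fin.≟ j
    ... | no _     | _        = z≤n
    ... | yes _    | yes _    = ≤-refl
    ... | yes px≡a | no cx≢j = ⊥-elim (cx≢j (coloured-j x px≡a))

  criticalBelow⇒≤ : ∀ {r} → CriticalChromaticBelow (completePartite p) r → k ≤ r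
  criticalBelow⇒≤ (χ , s , chromatic , _ , _ , bound) =
    subst (_≤ _) (completePartite-chromatic chromatic) (pred*<*∸⇒≤ χ _ n s bound)

  -- Each colour class of a proper k-colouring contains a whole part, so
  -- σ(B) ≥ M = n / k and χ_cr(B) ≥ (k - 1) n / (n - M) = k.
  equalParts⇒¬criticalBelow : ∀ {M} → (∀ a → partSize p a ≡ M) →
                              ¬ CriticalChromaticBelow (completePartite p) k
  equalParts⇒¬criticalBelow {M} sizes≡M (χ , s , chromatic , (smallest , _) , _ , bound) =
    balanced (completePartite-chromatic chromatic) smallest bound
    where
    n≡kM : n ≡ k * M
    n≡kM = trans (sym (∑-partSize p)) (trans (sum-cong-≗ sizes≡M) (∑-const k M))
    balanced : ∀ {χ s} → χ ≡ k →
      (Σ (Fin n → Fin χ) λ c → IsProperColouring (completePartite p) χ c ×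
                               Σ (Fin χ) λ j → classSize c j ≡ s) →
      ¬ ((χ ∸ 1) * n < k * (n ∸ s))
    balanced {s = s} refl (c , proper , j , size≡s)
      with a , part≤class ← partSize≤classSize proper j =
      ≤⇒≯ (subst (λ m → k * (m ∸ s) ≤ (k ∸ 1) * m) (sym n≡kM)
             (*∸≤pred* k M (subst₂ _≤_ (sizes≡M a) size≡s part≤class)))

-- Flexibility from a bottlegraph

vertex₀ : ∀ {n} t → 0 < n → Fin (n * suc t)
vertex₀ {suc n} t _ = zero

module _ {h} .{{_ : NonZero h}} (H : OGraph h) (simple : IsSimple H)
         {r} (chromatic : IsIntervalChromatic H r)
         {k n} {p : Fin n → Fin k} (nonempty : PartsNonempty p) (bottle : IsBottlegraph H p)
         (critical : CriticalChromaticBelow (completePartite p) r)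
         {i} (1≤i : 1 ≤ i) (i<r : i < r) where

  open IntervalColourings H simple
  open SumLeft (FlexibleAt H r i) 0ℓ using (applicative; monad)
  open RawMonad monad using (pure; _>>=_)

  private
    c₀ : Fin h → ℕ
    c₀ = proj₁ (proj₁ chromatic)
    C₀ : IsIntervalColouring H r c₀
    C₀ = proj₂ (proj₁ chromatic)
    β : ℕ
    β = countBelow i c₀
    0<n : 0 < n
    0<n = let _ , _ , _ , _ , s<n , _ = critical in ≤-<-trans z≤n s<n

  k≤r : k ≤ r
  k≤r = criticalBelow⇒≤ p nonempty critical

  r≤k : r ≤ k
  r≤k with φ , labelling ← intervalLabelling p Perm.id
      with t , _ , f , embedding , _ , covering ← bottle Perm.id φ labelling
      with j , _ ← covering (vertex₀ t 0<n) =
    ≮⇒≥ λ k<r → proj₂ chromatic k k<r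
      (_ , embedding⇒intervalColouring p Perm.id φ labelling (embedding j))

  partsBelow : Permutation′ k → ℕ
  partsBelow σ = ∑[ x < n ] indicator (toℕ (σ ⟨$⟩ʳ p x) <? i)

  flexibleAt-or-partsBelow : ∀ σ → FlexibleAt H r i ⊎ partsBelow σ * h ≡ n * β
  flexibleAt-or-partsBelow σ
    with φ , labelling ← intervalLabelling p σ
    with t , q , f , embedding , disjoint , covering ← bottle σ φ labelling = do
    copies ← sequence applicative λ j →
      flexibleAt-or-countBelow-≡ C₀
        (intervalColouring-≤ k≤r (embedding⇒intervalColouring p σ φ labelling (embedding j)))
        1≤i i<r
    pure (trans (cong (_* h) (sum-permute below (flip φ)))
                (tiling-blockWeight f disjoint covering (below ∘ (φ ⟨$⟩ˡ_)) (sym ∘ copies)))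
    where
    below : Fin n → ℕ
    below x = indicator (toℕ (σ ⟨$⟩ʳ p x) <? i)

  partsBelow-transpose : ∀ a b → toℕ a < i → i ≤ toℕ b →
    partsBelow Perm.id + partSize p b ≡ partsBelow (Perm.transpose a b) + partSize p a
  partsBelow-transpose a b a<i i≤b = begin
    partsBelow Perm.id + partSize p b
      ≡⟨ ∑-distrib-+ (λ x → indicator (toℕ (p x) <? i)) (λ x → indicator (p x Fin.≟ b)) ⟨
    ∑[ x < n ] (indicator (toℕ (p x) <? i) + indicator (p x Fin.≟ b))
      ≡⟨ sum-cong-≗ (λ x → indicator-transpose a b (p x) a<i i≤b) ⟩
    ∑[ x < n ] (indicator (toℕ (Perm.transpose a b ⟨$⟩ʳ p x) <? i) + indicator (p x Fin.≟ a))
      ≡⟨ ∑-distrib-+ _ (λ x → indicator (p x Fin.≟ a)) ⟩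
    partsBelow (Perm.transpose a b) + partSize p a ∎
    where open ≡-Reasoning

  flexibleAt-or-partSize-≡ : ∀ a b → toℕ a < i → i ≤ toℕ b →
                             FlexibleAt H r i ⊎ partSize p a ≡ partSize p b
  flexibleAt-or-partSize-≡ a b a<i i≤b = do
    id-count ← flexibleAt-or-partsBelow Perm.id
    τ-count  ← flexibleAt-or-partsBelow (Perm.transpose a b)
    let same = *-cancelʳ-≡ _ _ h (trans id-count (sym τ-count))
    pure (sym (+-cancelˡ-≡ _ _ _ (trans (partsBelow-transpose a b a<i i≤b)
                                        (cong (_+ partSize p a) (sym same)))))

  private
    i<k : i < k
    i<k = <-≤-trans i<r r≤k
    top bottom : Fin k
    top = fromℕ< i<k
    bottom = fromℕ< (<-trans 1≤i i<k)
    i≤top : i ≤ toℕ top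
    i≤top = ≤-reflexive (sym (Fin.toℕ-fromℕ< i<k))
    bottom<i : toℕ bottom < i
    bottom<i = subst (_< i) (sym (Fin.toℕ-fromℕ< _)) 1≤i

  flexibleAt-or-equalParts : FlexibleAt H r i ⊎ (∀ a → partSize p a ≡ partSize p top)
  flexibleAt-or-equalParts = sequence applicative λ a → sameSizeAsTop a (toℕ a <? i)
    where
    sameSizeAsTop : ∀ a → Dec (toℕ a < i) → FlexibleAt H r i ⊎ partSize p a ≡ partSize p top
    sameSizeAsTop a (yes a<i) = flexibleAt-or-partSize-≡ a top a<i i≤top
    sameSizeAsTop a (no a≮i)  = do
      bottom≡a ← flexibleAt-or-partSize-≡ bottom a bottom<i (≮⇒≥ a≮i)
      bottom≡top ← flexibleAt-or-partSize-≡ bottom top bottom<i i≤top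
      pure (trans (sym bottom≡a) bottom≡top)

  criticalBottlegraph⇒flexibleAt : FlexibleAt H r i
  criticalBottlegraph⇒flexibleAt =
    [ id , (λ sizes≡ → ⊥-elim (equalParts⇒¬criticalBelow p nonempty sizes≡ criticalₖ)) ]′
      flexibleAt-or-equalParts
    where
    criticalₖ : CriticalChromaticBelow (completePartite p) k
    criticalₖ = subst (CriticalChromaticBelow _) (≤-antisym r≤k k≤r) critical

corollary8p5 : ∀ {h} (H : OGraph h) → IsSimple H → (r : ℕ) →
                 IsIntervalChromatic H r → CrStarBelow H r → Flexible H r
corollary8p5 {zero} H _ r (_ , minimal) _ i 1≤i i<r =
  ⊥-elim (minimal 0 (<-trans 1≤i i<r) ((λ ()) , (λ ()) , (λ ()) , (λ ())))
corollary8p5 {suc _} H simple r chromatic (_ , _ , _ , nonempty , bottle , critical) i 1≤i i<r =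
  criticalBottlegraph⇒flexibleAt H simple chromatic nonempty bottle critical 1≤i i<r
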